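{- Let $\Delta$ be of type $G_2$ with simple roots $\alpha_1,\alpha_2$. Let $\alpha,\beta\in\Delta$ with $\langle\alpha,\beta^\vee\rangle\le0$, $\alpha\ne-\beta$, let $\Pi=(\gamma_1,\dots,\gamma_q)=(\alpha,s_\alpha(\beta),s_\alpha s_\beta(\alpha),\dots,s_\beta(\alpha),\beta)$ and $\Pi'=(\gamma_q,\dots,\gamma_1)$. Let $v\in W$ and $\mathbf p\in\mathcal P(v,\Pi)$, and assume that none of the following cases occurs: (E1) $\Pi=(\pm(3\alpha_1+2\alpha_2),\pm(2\alpha_1+\alpha_2),\pm(3\alpha_1+\alpha_2),\pm\alpha_1,\mp\alpha_2,\mp(\alpha_1+\alpha_2))$, $v=s_1s_2s_1$, $\mathrm{end}(\mathbf p)=s_1s_2$, $\mathrm{wt}(\mathbf p)=\alpha_1^\vee+\alpha_2^\vee$; (E2) $\Pi=(\pm(\alpha_1+\alpha_2),\pm\alpha_2,\mp\alpha_1,\mp(3\alpha_1+\alpha_2),\mp(2\alpha_1+\alpha_2),\mp(3\alpha_1+2\alpha_2))$, $v=s_1s_2s_1$, $\mathrm{end}(\mathbf p)=s_1s_2$, $\mathrm{wt}(\mathbf p)=\alpha_1^\vee+\alpha_2^\vee$; (E3) $\Pi$ as in (E1), $v=s_2s_1s_2s_1$, $\mathrm{end}(\mathbf p)=s_2s_1s_2$, $\mathrm{wt}(\mathbf p)=\alpha_1^\vee+\alpha_2^\vee$; (E4) $\Pi$ as in (E2), $v=s_2s_1s_2s_1$, $\mathrm{end}(\mathbf p)=s_2s_1s_2$,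 $\mathrm{wt}(\mathbf p)=\alpha_1^\vee+\alpha_2^\vee$. Then exactly one of the following occurs: (1) there is a unique $\mathbf p'\in\mathcal P(v,\Pi)\setminus\{\mathbf p\}$ with the same end and wt as $\mathbf p$; it satisfies $(-1)^{\mathrm{neg}(\mathbf p')}=-(-1)^{\mathrm{neg}(\mathbf p)}$; and no $\mathbf q\in\mathcal P(v,\Pi')$ has the same end and wt as $\mathbf p$; (2) there is a unique $\mathbf p'\in\mathcal P(v,\Pi')$ with the same end and wt as $\mathbf p$; it satisfies $(-1)^{\mathrm{neg}(\mathbf p')}=(-1)^{\mathrm{neg}(\mathbf p)}$; and no $\mathbf q\in\mathcal P(v,\Pi)\setminus\{\mathbf p\}$ has the same end and wt as $\mathbf p$; (3) there is a unique $\mathbf p'\in\mathcal P(v,\Pi)\setminus\{\mathbf p\}$ with the same end and wt as $\mathbf p$; it satisfies $(-1)^{\mathrm{neg}(\mathbf p')}=-(-1)^{\mathrm{neg}(\mathbf p)}$; and there are exactly two paths $\mathbf q_1,\mathbf q_2\in\mathcal P(v,\Pi')$ with the same end and wt as $\mathbf p$, and they satisfy $(-1)^{\mathrm{neg}(\mathbf q_2)}=-(-1)^{\mathrm{neg}(\mathbf q_1)}$.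
   Context: $W$ is the Weyl group (simple reflections $s_1,s_2$, length $\ell$, reflections $s_\gamma$), $\rho=\frac12\sum_{\gamma\in\Delta^+}\gamma$, $|\gamma|=\pm\gamma\in\Delta^+$. In $\Pi$ the $k$-th entry is obtained by applying $k-1$ alternating reflections $s_\alpha s_\beta\cdots$ (starting with $s_\alpha$) to $\alpha$ ($k$ odd) or $\beta$ ($k$ even), and $q$ is such that the last entry is $\beta$. $\mathrm{QBG}(W)$: vertices $W$, edges $x\xrightarrow{\gamma}xs_\gamma$ ($\gamma\in\Delta^+$) iff $\ell(xs_\gamma)=\ell(x)+1$ (Bruhat) or $\ell(xs_\gamma)=\ell(x)-2\langle\rho,\gamma^\vee\rangle+1$ (quantum). $\mathcal P(v,\Pi)$ is the set of index sequences $1\le j_1<\dots<j_p\le q$ such that $v\xrightarrow{|\gamma_{j_1}|}\cdots\xrightarrow{|\gamma_{j_p}|}w_p$ is a directed path in $\mathrm{QBG}(W)$; $\mathrm{end}(\mathbf p)=w_p$, $\mathrm{wt}(\mathbf p)$ is the sum of $|\gamma_{j_k}|^\vee$ over quantum edges, $\mathrm{neg}(\mathbf p)=\#\{k:\gamma_{j_k}\in-\Delta^+\}$. -}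

module Defs where

open import Data.Nat using (ℕ; zero; suc)
open import Data.Integer using (ℤ; +_; -_; _+_; _-_; _*_; _≤_; ∣_∣; 0ℤ; 1ℤ; -1ℤ; _^_)
open import Data.Integer.DivMod using (_/ℕ_)
import Data.Integer.Properties as ℤP
open import Data.Fin using (Fin; opposite) renaming (_<_ to _<ᶠ_)
open import Data.List using (List; []; _∷_; _++_; map; foldr; length; tabulate)
open import Data.List.Relation.Unary.Linked using (Linked)
open import Data.List.Membership.Propositional using (_∈_)
open import Data.List.Membership.DecPropositional (ℤP._≟_) using () renaming (_∈?_ to _∈ℤ?_)
open import Data.Product using (_×_; _,_; Σ; ∃; ∃-syntax; proj₁; proj₂)
import Data.Product.Properties as ×P
open import Data.Sum using (_⊎_)
open import Data.Unit using (⊤)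
open import Data.Bool using (Bool; true; false; if_then_else_)
open import Data.Maybe using (Maybe; just; nothing)
open import Relation.Nullary using (Dec; yes; no; does; ¬_)
open import Relation.Binary.PropositionalEquality using (_≡_; _≢_)
open import Relation.Binary using (DecidableEquality)

-- The root lattice of G₂.  A vector (a , b) stands for a·α₁ + b·α₂,
-- α₁ the short and α₂ the long simple root (so 3α₁+2α₂ is a root).

V : Set
V = ℤ × ℤ

_≟V_ : DecidableEquality V
_≟V_ = ×P.≡-dec ℤP._≟_ ℤP._≟_

infixl 6 _+V_
_+V_ : V → V → V
(a , b) +V (c , d) = (a + c , b + d)

negV : V → V
negV (a , b) = (- a , - b)

scaleV : ℤ → V → V
scaleV k (a , b) = (k * a , k * b)

0V : V
0V = (0ℤ , 0ℤ)

form : V → V → ℤ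
form (a , b) (c , d) = + 2 * a * c - + 3 * (a * d + b * c) + + 6 * b * d

-- exact integer division (the divisor is (γ,γ) > 0 for γ a root)
quot : ℤ → ℕ → ℤ
quot x zero    = 0ℤ
quot x (suc n) = x /ℕ suc n

pair : V → V → ℤ
pair μ γ = quot (+ 2 * form μ γ) ∣ form γ γ ∣

-- the coroot γ^∨ = 2γ/(γ,γ), written in the basis α₁^∨ , α₂^∨
-- (α₁^∨ = α₁ and α₂^∨ = α₂/3 for this normalisation).
coroot : V → V
coroot (a , b) = (quot (+ 2 * a) N , quot (+ 6 * b) N)
  where N = ∣ form (a , b) (a , b) ∣

refl : V → V → V
refl γ μ = μ +V negV (scaleV (pair μ γ) γ)

posRoots : List V
posRoots = (+ 1 , + 0) ∷ (+ 0 , + 1) ∷ (+ 1 , + 1) ∷ (+ 2 , + 1)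
         ∷ (+ 3 , + 1) ∷ (+ 3 , + 2) ∷ []

roots : List V
roots = posRoots ++ map negV posRoots

IsRoot : V → Set
IsRoot γ = γ ∈ roots

α₁ α₂ : V
α₁ = (+ 1 , + 0)
α₂ = (+ 0 , + 1)

twoRho : V
twoRho = foldr _+V_ 0V posRoots

isPos : V → Bool
isPos γ = does (γ ∈V? posRoots)
  where
  open import Data.List.Membership.DecPropositional _≟V_ using () renaming (_∈?_ to _∈V?_)

absR : V → V
absR γ = if isPos γ then γ else negV γ

-- 2×2 integer matrices (action on the root lattice, columns = images
-- of α₁ , α₂).

record Mat : Set where
  constructor mat2
  field m11 m12 m21 m22 : ℤ

_≟M_ : DecidableEquality Mat
mat2 a b c d ≟M mat2 a' b' c' d' with ×P.≡-dec ℤP._≟_ (×P.≡-dec ℤP._≟_ (×P.≡-dec ℤP._≟_ ℤP._≟_)) (a , b , c , d) (a' , b' , c' , d')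
... | yes Relation.Binary.PropositionalEquality.refl = yes Relation.Binary.PropositionalEquality.refl
... | no ne = no λ { Relation.Binary.PropositionalEquality.refl → ne Relation.Binary.PropositionalEquality.refl }

_·M_ : Mat → Mat → Mat
mat2 a b c d ·M mat2 a' b' c' d' =
  mat2 (a * a' + b * c') (a * b' + b * d') (c * a' + d * c') (c * b' + d * d')

idM : Mat
idM = mat2 1ℤ 0ℤ 0ℤ 1ℤ

reflMat : V → Mat
reflMat γ with refl γ α₁ | refl γ α₂
... | (a , c) | (b , d) = mat2 a b c d

-- The Weyl group W of G₂ (dihedral of order 12), each element given by
-- its (unique up to the braid relation for w₀) reduced word in s₁ , s₂.

data Gen : Set where
  g₁ g₂ : Gen

data W : Set where
  e s1 s2 s12 s21 s121 s212 s1212 s2121 s12121 s21212 w0 : W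

word : W → List Gen
word e      = []
word s1     = g₁ ∷ []
word s2     = g₂ ∷ []
word s12    = g₁ ∷ g₂ ∷ []
word s21    = g₂ ∷ g₁ ∷ []
word s121   = g₁ ∷ g₂ ∷ g₁ ∷ []
word s212   = g₂ ∷ g₁ ∷ g₂ ∷ []
word s1212  = g₁ ∷ g₂ ∷ g₁ ∷ g₂ ∷ []
word s2121  = g₂ ∷ g₁ ∷ g₂ ∷ g₁ ∷ []
word s12121 = g₁ ∷ g₂ ∷ g₁ ∷ g₂ ∷ g₁ ∷ []
word s21212 = g₂ ∷ g₁ ∷ g₂ ∷ g₁ ∷ g₂ ∷ []
word w0     = g₁ ∷ g₂ ∷ g₁ ∷ g₂ ∷ g₁ ∷ g₂ ∷ []

allW : List W
allW = e ∷ s1 ∷ s2 ∷ s12 ∷ s21 ∷ s121 ∷ s212 ∷ s1212 ∷ s2121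
     ∷ s12121 ∷ s21212 ∷ w0 ∷ []

ℓ : W → ℕ
ℓ w = length (word w)

genMat : Gen → Mat
genMat g₁ = reflMat α₁
genMat g₂ = reflMat α₂

-- faithful action of w on the root lattice
matW : W → Mat
matW w = foldr (λ g M → genMat g ·M M) idM (word w)

-- x s_γ : the element of W acting as (action of x) ∘ s_γ
-- (always found in allW for γ a root; the fallback is never used).
rmul : W → V → W
rmul x γ = go allW
  where
  go : List W → W
  go []       = x
  go (w ∷ ws) = if does (matW w ≟M (matW x ·M reflMat γ)) then w else go ws

BruhatEdge : W → V → Set
BruhatEdge x γ = + ℓ (rmul x γ) ≡ + ℓ x + 1ℤ

QuantumEdge : W → V → Set
QuantumEdge x γ = + ℓ (rmul x γ) ≡ + ℓ x - pair twoRho γ + 1ℤ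

Edge : W → V → Set
Edge x γ = (γ ∈ posRoots) × (BruhatEdge x γ ⊎ QuantumEdge x γ)

isQuantum : W → V → Bool
isQuantum x γ = does (+ ℓ (rmul x γ) ℤP.≟ (+ ℓ x - pair twoRho γ + 1ℤ))

-- Paths along a sequence Π = (γ₁,…,γ_q) given as Fin q → V.
-- A path is an index sequence j₁ < … < j_p (a list of Fin q).

module _ {q : ℕ} (Π : Fin q → V) where

  endP : W → List (Fin q) → W
  endP v []       = v
  endP v (j ∷ js) = endP (rmul v (absR (Π j))) js

  Steps : W → List (Fin q) → Set
  Steps v []       = ⊤
  Steps v (j ∷ js) = Edge v (absR (Π j)) × Steps (rmul v (absR (Π j))) js

  InP : W → List (Fin q) → Set
  InP v js = Linked _<ᶠ_ js × Steps v js

  -- sum of |γ_{j_k}|^∨ over the quantum edges (coroot-basis coordinates)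
  wtP : W → List (Fin q) → V
  wtP v []       = 0V
  wtP v (j ∷ js) =
    (if isQuantum v (absR (Π j)) then coroot (absR (Π j)) else 0V)
    +V wtP (rmul v (absR (Π j))) js

  negP : List (Fin q) → ℕ
  negP []       = 0
  negP (j ∷ js) = (if isPos (negV (Π j)) then 1 else 0) Data.Nat.+ negP js

sgn : ℕ → ℤ
sgn n = -1ℤ ^ n

-- The sequence Π(α,β):  k-th entry (k = i+1) is  (s_α s_β ⋯)(i factors)
-- applied to α (i even) or β (i odd).

altApply : V → V → ℕ → V → V
altApply a b zero    μ = μ
altApply a b (suc n) μ = refl a (altApply b a n μ)

isEven : ℕ → Bool
isEven zero          = true
isEven (suc zero)    = false
isEven (suc (suc n)) = isEven n

gammaSeq : V → V → ℕ → V
gammaSeq α β i = altApply α β i (if isEven i then α else β)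

PiSeq : (α β : V) (q : ℕ) → Fin q → V
PiSeq α β q i = gammaSeq α β (Data.Fin.toℕ i)

revSeq : {q : ℕ} → (Fin q → V) → Fin q → V
revSeq Π i = Π (opposite i)

vec : ℤ → ℤ → V
vec a b = (a , b)

E1list : List V
E1list = vec (+ 3) (+ 2) ∷ vec (+ 2) (+ 1) ∷ vec (+ 3) (+ 1) ∷ vec (+ 1) (+ 0)
       ∷ vec (+ 0) (- + 1) ∷ vec (- + 1) (- + 1) ∷ []

E2list : List V
E2list = vec (+ 1) (+ 1) ∷ vec (+ 0) (+ 1) ∷ vec (- + 1) (+ 0) ∷ vec (- + 3) (- + 1)
       ∷ vec (- + 2) (- + 1) ∷ vec (- + 3) (- + 2) ∷ []

-- α₁^∨ + α₂^∨ in coroot coordinates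
corootSum : V
corootSum = (+ 1 , + 1)

module _ {q : ℕ} (Π : Fin q → V) (v : W) (p : List (Fin q)) where

  ΠisE1 ΠisE2 : Set
  ΠisE1 = tabulate Π ≡ E1list ⊎ tabulate Π ≡ map negV E1list
  ΠisE2 = tabulate Π ≡ E2list ⊎ tabulate Π ≡ map negV E2list

  Exceptional : Set
  Exceptional =
      (ΠisE1 × v ≡ s121 × endP Π v p ≡ s12 × wtP Π v p ≡ corootSum)
    ⊎ (ΠisE2 × v ≡ s121 × endP Π v p ≡ s12 × wtP Π v p ≡ corootSum)
    ⊎ (ΠisE1 × v ≡ s2121 × endP Π v p ≡ s212 × wtP Π v p ≡ corootSum)
    ⊎ (ΠisE2 × v ≡ s2121 × endP Π v p ≡ s212 × wtP Π v p ≡ corootSum)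

  Π' : Fin q → V
  Π' = revSeq Π

  Matches : (Fin q → V) → List (Fin q) → Set
  Matches Σ r = InP Σ v r × endP Σ v r ≡ endP Π v p × wtP Σ v r ≡ wtP Π v p

  UniqueOtherOpp : Set
  UniqueOtherOpp = ∃[ p' ] (Matches Π p' × p' ≢ p
    × (∀ r → Matches Π r → r ≢ p → r ≡ p')
    × sgn (negP Π p') ≡ - sgn (negP Π p))

  NoneOther : Set
  NoneOther = ∀ r → Matches Π r → r ≡ p

  NoneRev : Set
  NoneRev = ∀ r → ¬ Matches Π' r

  Case1 Case2 Case3 : Set
  Case1 = UniqueOtherOpp × NoneRev
  Case2 = (∃[ p' ] (Matches Π' p'
            × (∀ r → Matches Π' r → r ≡ p')
            × sgn (negP Π' p') ≡ sgn (negP Π p)))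
          × NoneOther
  Case3 = UniqueOtherOpp
          × (∃[ q₁ ] ∃[ q₂ ] (Matches Π' q₁ × Matches Π' q₂ × q₁ ≢ q₂
              × (∀ r → Matches Π' r → r ≡ q₁ ⊎ r ≡ q₂)
              × sgn (negP Π' q₂) ≡ - sgn (negP Π' q₁)))

  ExactlyOne : Set
  ExactlyOne = (Case1 × ¬ Case2 × ¬ Case3)
             ⊎ (¬ Case1 × Case2 × ¬ Case3)
             ⊎ (¬ Case1 × ¬ Case2 × Case3)

-- Everything in the statement is finite: twelve roots, hence finitely many admissible pairs (α, β),
-- each giving a sequence Π of length two, three or six, and a Weyl group of order twelve.  For every
-- pair and every v we list all increasing index sequences, keep the quantum Bruhat paths, and check
-- that for each non-exceptional path p the other Π-paths and the Π'-paths with the same end and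
-- weight as p fall into one of the three configurations of the statement, with the required signs.
-- The check is run by evaluation; it is sound because the enumeration is complete and because the
-- steps x ↦ x s_γ are read off a memo table that agrees with rmul.

module Submission where

open import Defs hiding (refl)
open import Data.Bool using (Bool; true; T; _∧_; if_then_else_)
open import Data.Bool.Properties using (T-∧)
open import Data.Empty using (⊥-elim)
open import Data.Fin as Fin using (Fin; zero; suc; opposite)
open import Data.Fin.Properties using (all?)
open import Data.Integer as ℤ using (ℤ; +_; -_; 0ℤ; 1ℤ) renaming (_≤_ to _≤ℤ_)
import Data.Integer.Properties as ℤP
open import Data.List as List using (List; []; _∷_; _++_; map; filter; length; tabulate)
open import Data.List.Membership.Propositional using (_∈_)
open import Data.List.Membership.Propositional.Properties
  using (∈-filter⁺; ∈-filter⁻; ∈-map⁺; ∈-map⁻; ∈-++⁺ˡ; ∈-++⁺ʳ)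
import Data.List.Membership.DecPropositional _≟V_ as RootMembership
import Data.List.Properties as ListP
open import Data.List.Relation.Unary.All as All using (All)
open import Data.List.Relation.Unary.Any using (here; there; index)
open import Data.List.Relation.Unary.Any.Properties using (lookup-index; singleton⁻)
open import Data.List.Relation.Unary.Linked as Linked using (Linked; linked?)
import Data.List.Relation.Unary.Linked.Properties as LinkedP
open import Data.Nat as ℕ using (ℕ; zero; suc; _<_; _≤_; _∸_)
import Data.Nat
import Data.Nat.Properties as ℕP
open import Data.Product as Product using (∃-syntax; _×_; _,_; proj₁; proj₂)
import Data.Product.Properties as ×P
open import Data.Sum using (_⊎_; inj₁; inj₂; [_,_]′)
open import Data.Vec as Vec using (Vec)
import Data.Vec.Properties as VecP
open import Function using (_∘_; Equivalence)
open import Relation.Binary using (DecidableEquality)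
open import Relation.Unary using (Decidable)
open import Relation.Binary.Definitions using (tri<; tri≈; tri>)
open import Relation.Binary.PropositionalEquality
  using (_≡_; _≢_; _≗_; refl; sym; trans; cong; cong₂; subst; subst₂)
open import Relation.Nullary using (¬_; Dec; yes; no; does; isYes)
open import Relation.Nullary.Decidable
  using (map′; _×-dec_; _⊎-dec_; _→-dec_; ¬?; toWitness; fromWitness; T?)

∈-allW : ∀ w → w ∈ allW
∈-allW e      = here refl
∈-allW s1     = there (here refl)
∈-allW s2     = there (there (here refl))
∈-allW s12    = there (there (there (here refl)))
∈-allW s21    = there (there (there (there (here refl))))
∈-allW s121   = there (there (there (there (there (here refl)))))
∈-allW s212   = there (there (there (there (there (there (here refl))))))
∈-allW s1212  = there (there (there (there (there (there (there (here refl)))))))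
∈-allW s2121  = there (there (there (there (there (there (there (there (here refl))))))))
∈-allW s12121 = there (there (there (there (there (there (there (there (there (here refl)))))))))
∈-allW s21212 = there (there (there (there (there (there (there (there (there (there (here refl))))))))))
∈-allW w0     = there (there (there (there (there (there (there (there (there (there (there (here refl)))))))))))

indexW : W → Fin (length allW)
indexW = index ∘ ∈-allW

_≟W_ : DecidableEquality W
x ≟W y = map′ indexW-injective (cong indexW) (indexW x Fin.≟ indexW y)
  where
  indexW-injective : indexW x ≡ indexW y → x ≡ y
  indexW-injective eq =
    trans (lookup-index (∈-allW x)) (trans (cong (List.lookup allW) eq) (sym (lookup-index (∈-allW y))))

∀W? : {P : W → Set} → (∀ w → Dec (P w)) → Dec (∀ w → P w)
∀W? P? = map′ (λ ps w → All.lookup ps (∈-allW w)) (λ f → All.tabulate (λ {w} _ → f w))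
               (All.all? P? allW)

-- Passed around as an argument, a memo table is evaluated at most once per entry.
memo : {A B : Set} (xs : List A) → (A → B) → Vec B (length xs)
memo xs f = Vec.tabulate (f ∘ List.lookup xs)

lookup-memo : {A B : Set} {xs : List A} (f : A → B) {x : A} (x∈xs : x ∈ xs) →
              Vec.lookup (memo xs f) (index x∈xs) ≡ f x
lookup-memo f x∈xs = trans (VecP.lookup∘tabulate _ (index x∈xs)) (cong f (sym (lookup-index x∈xs)))

memo₂ : {A B C : Set} (xs : List A) (ys : List B) → (A → B → C) → Vec (Vec C (length ys)) (length xs)
memo₂ xs ys f = memo xs (λ a → memo ys (f a))

lookup-memo₂ : {A B C : Set} {xs : List A} {ys : List B} (f : A → B → C) {x : A}
               (x∈xs : x ∈ xs) (k : Fin (length ys)) →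
               Vec.lookup (Vec.lookup (memo₂ xs ys f) (index x∈xs)) k ≡ f x (List.lookup ys k)
lookup-memo₂ {ys = ys} f {x} x∈xs k =
  trans (cong (λ row → Vec.lookup row k) (lookup-memo (λ a → memo ys (f a)) x∈xs))
        (VecP.lookup∘tabulate (f x ∘ List.lookup ys) k)

tag : {A B : Set} → (A → B) → List A → List (A × B)
tag f = map (λ a → a , f a)

select : {A B : Set} {P : B → Set} → Decidable P → List (A × B) → List A
select P? = map proj₁ ∘ filter (P? ∘ proj₂)

∈-select-tag⁺ : {A B : Set} {P : B → Set} (P? : Decidable P) {f : A → B} {xs : List A} {a : A} →
                a ∈ xs → P (f a) → a ∈ select P? (tag f xs)
∈-select-tag⁺ P? {f} a∈xs Pfa =
  ∈-map⁺ proj₁ (∈-filter⁺ (P? ∘ proj₂) (∈-map⁺ (λ a → a , f a) a∈xs) Pfa)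

∈-select-tag⁻ : {A B : Set} {P : B → Set} (P? : Decidable P) {f : A → B} {xs : List A} {a : A} →
                a ∈ select P? (tag f xs) → a ∈ xs × P (f a)
∈-select-tag⁻ P? {f} {xs} a∈ with ∈-map⁻ proj₁ a∈
... | _ , t∈ , refl with ∈-filter⁻ (P? ∘ proj₂) {xs = tag f xs} t∈
...   | t∈tag , Pt with ∈-map⁻ (λ a → a , f a) t∈tag
...     | _ , a∈xs , refl = a∈xs , Pt

increasing : (q : ℕ) → List (List (Fin q))
increasing zero    = [] ∷ []
increasing (suc q) = map (map suc) (increasing q) ++ map ((zero ∷_) ∘ map suc) (increasing q)

Linked-map-suc⁻ : ∀ {q} {xs : List (Fin q)} → Linked Fin._<_ (map suc xs) → Linked Fin._<_ xs
Linked-map-suc⁻ = Linked.map ℕ.s≤s⁻¹ ∘ LinkedP.map⁻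

Linked-tail-suc : ∀ {q} {x : Fin (suc q)} {rs} → Linked Fin._<_ (x ∷ rs) → ∃[ rs′ ] rs ≡ map suc rs′
Linked-tail-suc {rs = []}        _        = [] , refl
Linked-tail-suc {rs = zero ∷ _}  (() Linked.∷ _)
Linked-tail-suc {rs = suc i ∷ _} (_ Linked.∷ L) with Linked-tail-suc L
... | rs′ , eq = i ∷ rs′ , cong (suc i ∷_) eq

∈-increasing : ∀ {q} {r : List (Fin q)} → Linked Fin._<_ r → r ∈ increasing q
∈-increasing {zero}  {[]}    _ = here refl
∈-increasing {suc q} {[]}    _ = ∈-++⁺ˡ (∈-map⁺ (map suc) (∈-increasing {q} Linked.[]))
∈-increasing {suc q} {x ∷ _} L with Linked-tail-suc L
∈-increasing {suc q} {zero ∷ _}  L | rs′ , refl =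
  ∈-++⁺ʳ (map (map suc) (increasing q)) (∈-map⁺ _ (∈-increasing (Linked-map-suc⁻ (Linked.tail L))))
∈-increasing {suc q} {suc i ∷ _} L | rs′ , refl =
  ∈-++⁺ˡ (∈-map⁺ (map suc) (∈-increasing {r = i ∷ rs′} (Linked-map-suc⁻ L)))

record Step : Set where
  constructor step
  field
    target : W
    weight : V
    edge   : Bool

open Step

-- Stated for an arbitrary y so that x s_γ is computed only once per step.
EdgeTo : W → V → W → Set
EdgeTo x γ y =
  γ ∈ posRoots × (+ ℓ y ≡ + ℓ x ℤ.+ 1ℤ ⊎ + ℓ y ≡ + ℓ x ℤ.- pair twoRho γ ℤ.+ 1ℤ)

edgeTo? : ∀ x γ y → Dec (EdgeTo x γ y)
edgeTo? x γ y = γ RootMembership.∈? posRoots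
  ×-dec (+ ℓ y ℤP.≟ (+ ℓ x ℤ.+ 1ℤ) ⊎-dec + ℓ y ℤP.≟ (+ ℓ x ℤ.- pair twoRho γ ℤ.+ 1ℤ))

edge? : ∀ x γ → Dec (Edge x γ)
edge? x γ = edgeTo? x γ (rmul x γ)

-- The edge flag uses `isYes`, which is what `True (edge? x γ)` unfolds to (`does` is not).
stepTo : W → V → W → Step
stepTo x γ y = step y
  (if does (+ ℓ y ℤP.≟ (+ ℓ x ℤ.- pair twoRho γ ℤ.+ 1ℤ)) then coroot γ else 0V)
  (isYes (edgeTo? x γ y))

stepOf : W → V → Step
stepOf x γ = stepTo x γ (rmul x γ)

edgeOf⇒Edge : ∀ x γ → T (edge (stepOf x γ)) → Edge x γ
edgeOf⇒Edge x γ = toWitness {a? = edge? x γ}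

Edge⇒edgeOf : ∀ x γ → Edge x γ → T (edge (stepOf x γ))
Edge⇒edgeOf x γ = fromWitness {a? = edge? x γ}

weight-stepOf : ∀ x γ → weight (stepOf x γ) ≡ (if isQuantum x γ then coroot γ else 0V)
weight-stepOf x γ = refl

StepTable : Set
StepTable = Vec (Vec Step (length roots)) (length allW)

stepTable : StepTable
stepTable = memo₂ allW roots (λ x γ → stepOf x (absR γ))

CorrectStepTable : StepTable → Set
CorrectStepTable table =
  ∀ x k → Vec.lookup (Vec.lookup table (indexW x)) k ≡ stepOf x (absR (List.lookup roots k))

-- The implicit arguments here and in Soundness are spelled out: inferring them by unification
-- would make Agda evaluate rmul and the table.
stepTable-correct : CorrectStepTable stepTable
stepTable-correct x = lookup-memo₂ {xs = allW} {ys = roots} (λ y γ → stepOf y (absR γ)) (∈-allW x)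

Key : Set
Key = W × V

_≟K_ : DecidableEquality Key
_≟K_ = ×P.≡-dec _≟W_ _≟V_

module Walk {q : ℕ} (S : W → Fin q → Step) (negative : Fin q → Bool) where

  endS : W → List (Fin q) → W
  endS v []       = v
  endS v (j ∷ js) = endS (target (S v j)) js

  wtS : W → List (Fin q) → V
  wtS v []       = 0V
  wtS v (j ∷ js) = weight (S v j) +V wtS (target (S v j)) js

  edgesS : W → List (Fin q) → Bool
  edgesS v []       = true
  edgesS v (j ∷ js) = edge (S v j) ∧ edgesS (target (S v j)) js

  negS : List (Fin q) → ℕ
  negS []       = 0
  negS (j ∷ js) = (if negative j then 1 else 0) ℕ.+ negS js

  Valid : W → List (Fin q) → Set
  Valid v r = Linked Fin._<_ r × T (edgesS v r)

  valid? : ∀ v r → Dec (Valid v r)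
  valid? v r = linked? Fin._<?_ r ×-dec T? (edgesS v r)

  paths : W → List (List (Fin q))
  paths v = filter (valid? v) (increasing q)

  key : W → List (Fin q) → Key
  key v r = endS v r , wtS v r

  tagged : W → List (List (Fin q) × Key)
  tagged v = tag (key v) (paths v)

module WalkCorrect {q : ℕ} (Π : Fin q → V) (S : W → Fin q → Step) (negative : Fin q → Bool)
  (S-spec : ∀ x j → S x j ≡ stepOf x (absR (Π j)))
  (negative-spec : ∀ j → negative j ≡ isPos (negV (Π j))) where

  open Walk S negative

  endS≡endP : ∀ v r → endS v r ≡ endP Π v r
  endS≡endP v []       = refl
  endS≡endP v (j ∷ js) =
    trans (cong (λ s → endS (target s) js) (S-spec v j)) (endS≡endP (rmul v (absR (Π j))) js)

  wtS≡wtP : ∀ v r → wtS v r ≡ wtP Π v r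
  wtS≡wtP v []       = refl
  wtS≡wtP v (j ∷ js) =
    trans (cong (λ s → weight s +V wtS (target s) js) (S-spec v j))
          (cong₂ _+V_ (weight-stepOf v (absR (Π j))) (wtS≡wtP (rmul v (absR (Π j))) js))

  negS≡negP : ∀ r → negS r ≡ negP Π r
  negS≡negP []       = refl
  negS≡negP (j ∷ js) = cong₂ ℕ._+_ (cong (λ b → if b then 1 else 0) (negative-spec j)) (negS≡negP js)

  edgesS⇒Steps : ∀ v r → T (edgesS v r) → Steps Π v r
  edgesS⇒Steps v []       _ = _
  edgesS⇒Steps v (j ∷ js) t = split (Equivalence.to (T-∧ {edge (S v j)}) t)
    where
    split : T (edge (S v j)) × T (edgesS (target (S v j)) js) → Steps Π v (j ∷ js)
    split (first , rest) =
      edgeOf⇒Edge v (absR (Π j)) (subst (T ∘ edge) (S-spec v j) first) ,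
      edgesS⇒Steps (rmul v (absR (Π j))) js (subst (λ s → T (edgesS (target s) js)) (S-spec v j) rest)

  Steps⇒edgesS : ∀ v r → Steps Π v r → T (edgesS v r)
  Steps⇒edgesS v []       _               = _
  Steps⇒edgesS v (j ∷ js) (first , rest) =
    Equivalence.from (T-∧ {edge (S v j)} {edgesS (target (S v j)) js})
      ( subst (T ∘ edge) (sym (S-spec v j)) (Edge⇒edgeOf v (absR (Π j)) first)
      , subst (λ s → T (edgesS (target s) js)) (sym (S-spec v j)) (Steps⇒edgesS (rmul v (absR (Π j))) js rest))

  ∈-paths⁺ : ∀ {v r} → InP Π v r → r ∈ paths v
  ∈-paths⁺ {v} {r} (L , st) = ∈-filter⁺ (valid? v) (∈-increasing L) (L , Steps⇒edgesS v r st)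

  ∈-paths⁻ : ∀ {v r} → r ∈ paths v → InP Π v r
  ∈-paths⁻ {v} {r} r∈ = proj₁ valid , edgesS⇒Steps v r (proj₂ valid)
    where
    valid : Valid v r
    valid = proj₂ (∈-filter⁻ (valid? v) {xs = increasing q} r∈)

  ∈-matching⁺ : ∀ {v x w r} → InP Π v r × endP Π v r ≡ x × wtP Π v r ≡ w →
                r ∈ select (_≟K (x , w)) (tagged v)
  ∈-matching⁺ {v} {x} {w} {r} (ip , end≡ , wt≡) =
    ∈-select-tag⁺ (_≟K (x , w)) (∈-paths⁺ ip)
      (×P.×-≡,≡→≡ (trans (endS≡endP v r) end≡ , trans (wtS≡wtP v r) wt≡))

  ∈-matching⁻ : ∀ {v x w r} → r ∈ select (_≟K (x , w)) (tagged v) →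
                InP Π v r × endP Π v r ≡ x × wtP Π v r ≡ w
  ∈-matching⁻ {v} {x} {w} {r} r∈ with ∈-select-tag⁻ (_≟K (x , w)) r∈
  ... | r∈paths , key≡ with ×P.×-≡,≡←≡ key≡
  ...   | end≡ , wt≡ =
    ∈-paths⁻ r∈paths , trans (sym (endS≡endP v r)) end≡ , trans (sym (wtS≡wtP v r)) wt≡

data Shape {A : Set} (σ σ′ : A → ℤ) (s : ℤ) : List A → List A → Set where
  one-other               : ∀ {o} → σ o ≡ - s → Shape σ σ′ s (o ∷ []) []
  one-reversal            : ∀ {r} → σ′ r ≡ s → Shape σ σ′ s [] (r ∷ [])
  one-other-two-reversals : ∀ {o r₁ r₂} → σ o ≡ - s → r₁ ≢ r₂ → σ′ r₂ ≡ - σ′ r₁ →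
                            Shape σ σ′ s (o ∷ []) (r₁ ∷ r₂ ∷ [])

Shape-cong : ∀ {A : Set} {σ₁ σ₂ σ′₁ σ′₂ : A → ℤ} {s₁ s₂ O R} →
             σ₁ ≗ σ₂ → σ′₁ ≗ σ′₂ → s₁ ≡ s₂ → Shape σ₁ σ′₁ s₁ O R → Shape σ₂ σ′₂ s₂ O R
Shape-cong σ≗ σ′≗ refl (one-other {o} eq) = one-other (trans (sym (σ≗ o)) eq)
Shape-cong σ≗ σ′≗ refl (one-reversal {r} eq) = one-reversal (trans (sym (σ′≗ r)) eq)
Shape-cong σ≗ σ′≗ refl (one-other-two-reversals {o} {r₁} {r₂} eq r₁≢r₂ eq′) =
  one-other-two-reversals (trans (sym (σ≗ o)) eq) r₁≢r₂
    (trans (sym (σ′≗ r₂)) (trans eq′ (cong -_ (σ′≗ r₁))))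

shape? : ∀ {A : Set} → DecidableEquality A → (σ σ′ : A → ℤ) (s : ℤ) → ∀ O R →
         Dec (Shape σ σ′ s O R)
shape? _≟_ σ σ′ s (o ∷ []) [] = map′ one-other (λ { (one-other eq) → eq }) (σ o ℤP.≟ - s)
shape? _≟_ σ σ′ s [] (r ∷ []) = map′ one-reversal (λ { (one-reversal eq) → eq }) (σ′ r ℤP.≟ s)
shape? _≟_ σ σ′ s (o ∷ []) (r₁ ∷ r₂ ∷ []) =
  map′ (λ (eq , r₁≢r₂ , eq′) → one-other-two-reversals eq r₁≢r₂ eq′)
       (λ { (one-other-two-reversals eq r₁≢r₂ eq′) → eq , r₁≢r₂ , eq′ })
       (σ o ℤP.≟ - s ×-dec ¬? (r₁ ≟ r₂) ×-dec σ′ r₂ ℤP.≟ - σ′ r₁)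
shape? _≟_ σ σ′ s [] []                      = no λ ()
shape? _≟_ σ σ′ s [] (_ ∷ _ ∷ _)             = no λ ()
shape? _≟_ σ σ′ s (_ ∷ []) (_ ∷ [])          = no λ ()
shape? _≟_ σ σ′ s (_ ∷ []) (_ ∷ _ ∷ _ ∷ _)   = no λ ()
shape? _≟_ σ σ′ s (_ ∷ _ ∷ _) _              = no λ ()

module _ {q : ℕ} {Π : Fin q → V} {v : W} {p : List (Fin q)} where

  private
    HasOther HasReversed : Set
    HasOther    = ∃[ r ] (Matches Π v p Π r × r ≢ p)
    HasReversed = ∃[ r ] Matches Π v p (Π' Π v p) r

    uniqueOther⇒other : UniqueOtherOpp Π v p → HasOther
    uniqueOther⇒other (o , m , o≢p , _) = o , m , o≢p

    case1⇒¬reversed : Case1 Π v p → ¬ HasReversed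
    case1⇒¬reversed (_ , none) (r , m) = none r m

    case2⇒reversed : Case2 Π v p → HasReversed
    case2⇒reversed ((r , m , _) , _) = r , m

    case2⇒¬other : Case2 Π v p → ¬ HasOther
    case2⇒¬other (_ , none) (r , m , r≢p) = r≢p (none r m)

    case3⇒reversed : Case3 Π v p → HasReversed
    case3⇒reversed (_ , r , _ , m , _) = r , m

    uniqueOther : ∀ {o} →
      (∀ {r} → Matches Π v p Π r → r ≢ p → r ∈ o ∷ []) →
      (∀ {r} → r ∈ o ∷ [] → Matches Π v p Π r × r ≢ p) →
      sgn (negP Π o) ≡ - sgn (negP Π p) → UniqueOtherOpp Π v p
    uniqueOther O⁺ O⁻ sign =
      _ , proj₁ (O⁻ (here refl)) , proj₂ (O⁻ (here refl)) ,
      (λ r m r≢p → singleton⁻ (O⁺ m r≢p)) , sign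

  exactlyOne : ∀ {O R} →
    (∀ {r} → Matches Π v p Π r → r ≢ p → r ∈ O) →
    (∀ {r} → r ∈ O → Matches Π v p Π r × r ≢ p) →
    (∀ {r} → Matches Π v p (Π' Π v p) r → r ∈ R) →
    (∀ {r} → r ∈ R → Matches Π v p (Π' Π v p) r) →
    Shape (sgn ∘ negP Π) (sgn ∘ negP (Π' Π v p)) (sgn (negP Π p)) O R →
    ExactlyOne Π v p
  exactlyOne O⁺ O⁻ R⁺ R⁻ (one-other sign) =
    inj₁ ((uniqueOther O⁺ O⁻ sign , λ r m → noReversed (r , m)) ,
          (noReversed ∘ case2⇒reversed) , (noReversed ∘ case3⇒reversed))
    where
    noReversed : ¬ HasReversed
    noReversed (r , m) with R⁺ m
    ... | ()
  exactlyOne O⁺ O⁻ R⁺ R⁻ (one-reversal sign) =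
    inj₂ (inj₁ ((noOther ∘ uniqueOther⇒other ∘ proj₁) , (uniqueReversed , noneOther) ,
                (noOther ∘ uniqueOther⇒other ∘ proj₁)))
    where
    noOther : ¬ HasOther
    noOther (r , m , r≢p) with O⁺ m r≢p
    ... | ()
    noneOther : NoneOther Π v p
    noneOther r m with ListP.≡-dec Fin._≟_ r p
    ... | yes r≡p = r≡p
    ... | no r≢p  = ⊥-elim (noOther (r , m , r≢p))
    uniqueReversed : ∃[ p′ ] (Matches Π v p (Π' Π v p) p′
                             × (∀ r → Matches Π v p (Π' Π v p) r → r ≡ p′)
                             × sgn (negP (Π' Π v p) p′) ≡ sgn (negP Π p))
    uniqueReversed = _ , R⁻ (here refl) , (λ r m → singleton⁻ (R⁺ m)) , sign
  exactlyOne O⁺ O⁻ R⁺ R⁻ (one-other-two-reversals {r₁ = r₁} {r₂} sign r₁≢r₂ sign′) =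
    inj₂ (inj₂ ((λ c1 → case1⇒¬reversed c1 (r₁ , R⁻ (here refl))) ,
                (λ c2 → case2⇒¬other c2 (uniqueOther⇒other unique)) ,
                (unique , r₁ , r₂ , R⁻ (here refl) , R⁻ (there (here refl)) ,
                 r₁≢r₂ , oneOfTwo , sign′)))
    where
    unique : UniqueOtherOpp Π v p
    unique = uniqueOther O⁺ O⁻ sign
    oneOfTwo : ∀ r → Matches Π v p (Π' Π v p) r → r ≡ r₁ ⊎ r ≡ r₂
    oneOfTwo r m with R⁺ m
    ... | here r≡r₁         = inj₁ r≡r₁
    ... | there (here r≡r₂) = inj₂ r≡r₂

IsE1 IsE2 : ∀ {q} → (Fin q → V) → Set
IsE1 Π = tabulate Π ≡ E1list ⊎ tabulate Π ≡ map negV E1list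
IsE2 Π = tabulate Π ≡ E2list ⊎ tabulate Π ≡ map negV E2list

isE1? : ∀ {q} (Π : Fin q → V) → Dec (IsE1 Π)
isE1? Π = ListP.≡-dec _≟V_ (tabulate Π) E1list ⊎-dec ListP.≡-dec _≟V_ (tabulate Π) (map negV E1list)
isE2? : ∀ {q} (Π : Fin q → V) → Dec (IsE2 Π)
isE2? Π = ListP.≡-dec _≟V_ (tabulate Π) E2list ⊎-dec ListP.≡-dec _≟V_ (tabulate Π) (map negV E2list)

ExceptionalAt : Set → Set → W → W → V → Set
ExceptionalAt E₁ E₂ v x w =
    (E₁ × v ≡ s121 × x ≡ s12 × w ≡ corootSum)
  ⊎ (E₂ × v ≡ s121 × x ≡ s12 × w ≡ corootSum)
  ⊎ (E₁ × v ≡ s2121 × x ≡ s212 × w ≡ corootSum)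
  ⊎ (E₂ × v ≡ s2121 × x ≡ s212 × w ≡ corootSum)

exceptionalAt? : ∀ {E₁ E₂} → Dec E₁ → Dec E₂ → ∀ v x w → Dec (ExceptionalAt E₁ E₂ v x w)
exceptionalAt? e₁? e₂? v x w =
  case e₁? s121 s12 ⊎-dec case e₂? s121 s12 ⊎-dec case e₁? s2121 s212 ⊎-dec case e₂? s2121 s212
  where
  case : ∀ {E} → Dec E → ∀ v′ x′ → Dec (E × v ≡ v′ × x ≡ x′ × w ≡ corootSum)
  case e? v′ x′ = e? ×-dec v ≟W v′ ×-dec x ≟W x′ ×-dec w ≟V corootSum

module Certificate {q : ℕ} (Π : Fin q → V) (S : W → Fin q → Step) (negative : Fin q → Bool) where

  Path : Set
  Path = List (Fin q)

  _≟P_ : DecidableEquality Path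
  _≟P_ = ListP.≡-dec Fin._≟_

  open Walk S negative public
  module Rev = Walk (λ x j → S x (opposite j)) (negative ∘ opposite)

  others : Path → Key → List (Path × Key) → List Path
  others p k T = filter (λ r → ¬? (r ≟P p)) (select (_≟K k) T)

  EntryCert : W → List (Path × Key) → List (Path × Key) → Path × Key → Set
  EntryCert v T T′ (p , k) =
    ExceptionalAt (IsE1 Π) (IsE2 Π) v (proj₁ k) (proj₂ k)
    ⊎ Shape (sgn ∘ negS) (sgn ∘ Rev.negS) (sgn (negS p)) (others p k T) (select (_≟K k) T′)

  entryCert? : Dec (IsE1 Π) → Dec (IsE2 Π) → ∀ v T T′ e → Dec (EntryCert v T T′ e)
  entryCert? e₁? e₂? v T T′ (p , k) =
    exceptionalAt? e₁? e₂? v (proj₁ k) (proj₂ k)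
    ⊎-dec shape? _≟P_ (sgn ∘ negS) (sgn ∘ Rev.negS) (sgn (negS p)) (others p k T) (select (_≟K k) T′)

  VertexCert : W → Set
  VertexCert v = All (EntryCert v (tagged v) (Rev.tagged v)) (tagged v)

  vertexCert? : Dec (IsE1 Π) → Dec (IsE2 Π) → ∀ v → Dec (VertexCert v)
  vertexCert? e₁? e₂? v = entries? (tagged v) (Rev.tagged v)
    where
    -- The tagged lists are arguments, so they are computed once per vertex.
    entries? : ∀ T T′ → Dec (All (EntryCert v T T′) T)
    entries? T T′ = All.all? (entryCert? e₁? e₂? v T T′) T

RootIndices : ℕ → Set
RootIndices q = Vec (Fin (length roots)) q

-- The fallback index is junk: ConfigCertAt checks every index it uses.
rootIndex : V → Fin (length roots)
rootIndex γ with γ RootMembership.∈? roots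
... | yes γ∈roots = index γ∈roots
... | no _        = zero

memoStep : ∀ {q} → StepTable → RootIndices q → W → Fin q → Step
memoStep table ix x j = Vec.lookup (Vec.lookup table (indexW x)) (Vec.lookup ix j)

negatives : ∀ {q} → RootIndices q → Vec Bool q
negatives = Vec.map (λ k → isPos (negV (List.lookup roots k)))

ConfigCertAt : ∀ {q} → StepTable → (Fin q → V) → RootIndices q → Set
ConfigCertAt table Π ix =
  (∀ j → Π j ≡ List.lookup roots (Vec.lookup ix j))
  × (∀ v → Certificate.VertexCert Π (memoStep table ix) (Vec.lookup (negatives ix)) v)

configCertAt? : ∀ {q} table (Π : Fin q → V) ix → Dec (ConfigCertAt table Π ix)
configCertAt? table Π ix =
  all? (λ j → Π j ≟V List.lookup roots (Vec.lookup ix j))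
  ×-dec ∀W? (Certificate.vertexCert? Π (memoStep table ix) (Vec.lookup (negatives ix)) (isE1? Π) (isE2? Π))

module Soundness {table : StepTable} (table-spec : CorrectStepTable table)
  {q : ℕ} {Π : Fin q → V} {ix : RootIndices q}
  (Π≡ : ∀ j → Π j ≡ List.lookup roots (Vec.lookup ix j)) where

  private
    S : W → Fin q → Step
    S = memoStep table ix

    S-spec : ∀ x j → S x j ≡ stepOf x (absR (Π j))
    S-spec x j = subst (λ γ → S x j ≡ stepOf x (absR γ)) {x = List.lookup roots (Vec.lookup ix j)} {y = Π j}
                       (sym (Π≡ j)) (table-spec x (Vec.lookup ix j))

    negative-spec : ∀ j → Vec.lookup (negatives ix) j ≡ isPos (negV (Π j))
    negative-spec j = trans (VecP.lookup-map j (λ k → isPos (negV (List.lookup roots k))) ix)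
                            (cong (λ γ → isPos (negV γ)) {x = List.lookup roots (Vec.lookup ix j)} {y = Π j}
                                  (sym (Π≡ j)))

    S-spec′ : ∀ x j → S x (opposite j) ≡ stepOf x (absR (revSeq Π j))
    S-spec′ x j = subst (λ γ → S x (opposite j) ≡ stepOf x (absR γ)) {x = Π (opposite j)} {y = revSeq Π j}
                        refl (S-spec x (opposite j))

    negative-spec′ : ∀ j → Vec.lookup (negatives ix) (opposite j) ≡ isPos (negV (revSeq Π j))
    negative-spec′ j = subst (λ γ → Vec.lookup (negatives ix) (opposite j) ≡ isPos (negV γ))
                             {x = Π (opposite j)} {y = revSeq Π j} refl (negative-spec (opposite j))

    module F = WalkCorrect Π S (Vec.lookup (negatives ix)) S-spec negative-spec
    module R = WalkCorrect (revSeq Π) (λ x j → S x (opposite j)) (Vec.lookup (negatives ix) ∘ opposite)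
                 S-spec′ negative-spec′
    open Certificate Π S (Vec.lookup (negatives ix))

  vertexSound : ∀ {v p} → VertexCert v → InP Π v p → ¬ Exceptional Π v p → ExactlyOne Π v p
  vertexSound {v} {p} cert ip nex =
    [ ⊥-elim ∘ nex ∘ exceptional , classified ]′
      (All.lookup cert (∈-map⁺ (λ r → r , key v r) (F.∈-paths⁺ ip)))
    where
    end≡ : endS v p ≡ endP Π v p
    end≡ = F.endS≡endP v p
    wt≡ : wtS v p ≡ wtP Π v p
    wt≡ = F.wtS≡wtP v p

    exceptional : ExceptionalAt (IsE1 Π) (IsE2 Π) v (endS v p) (wtS v p) → Exceptional Π v p
    exceptional = subst₂ (ExceptionalAt (IsE1 Π) (IsE2 Π) v) end≡ wt≡

    toFast : ∀ {Σ r} → Matches Π v p Σ r → InP Σ v r × endP Σ v r ≡ endS v p × wtP Σ v r ≡ wtS v p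
    toFast (ip′ , end≡′ , wt≡′) = ip′ , trans end≡′ (sym end≡) , trans wt≡′ (sym wt≡)

    fromFast : ∀ {Σ r} → InP Σ v r × endP Σ v r ≡ endS v p × wtP Σ v r ≡ wtS v p → Matches Π v p Σ r
    fromFast (ip′ , end≡′ , wt≡′) = ip′ , trans end≡′ end≡ , trans wt≡′ wt≡

    Others Reversals : List Path
    Others    = others p (key v p) (tagged v)
    Reversals = select (_≟K key v p) (Rev.tagged v)

    O⁺ : ∀ {r} → Matches Π v p Π r → r ≢ p → r ∈ Others
    O⁺ m = ∈-filter⁺ (λ r → ¬? (r ≟P p)) (F.∈-matching⁺ (toFast m))

    O⁻ : ∀ {r} → r ∈ Others → Matches Π v p Π r × r ≢ p
    O⁻ = Product.map₁ (fromFast ∘ F.∈-matching⁻)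
       ∘ ∈-filter⁻ (λ r → ¬? (r ≟P p)) {xs = select (_≟K key v p) (tagged v)}

    R⁺ : ∀ {r} → Matches Π v p (Π' Π v p) r → r ∈ Reversals
    R⁺ = R.∈-matching⁺ ∘ toFast

    R⁻ : ∀ {r} → r ∈ Reversals → Matches Π v p (Π' Π v p) r
    R⁻ = fromFast ∘ R.∈-matching⁻

    classified : Shape (sgn ∘ negS) (sgn ∘ Rev.negS) (sgn (negS p)) Others Reversals → ExactlyOne Π v p
    classified = exactlyOne O⁺ O⁻ R⁺ R⁻
               ∘ Shape-cong (cong sgn ∘ F.negS≡negP) (cong sgn ∘ R.negS≡negP) (cong sgn (F.negS≡negP p))

configSound : ∀ {table} → CorrectStepTable table → ∀ {q} {Π : Fin q → V} {ix} →
              ConfigCertAt table Π ix → ∀ v p → InP Π v p → ¬ Exceptional Π v p → ExactlyOne Π v p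
configSound {table} spec {Π = Π} {ix} (Π≡ , certs) v p =
  Soundness.vertexSound {table} spec {Π = Π} {ix} Π≡ {v} {p} (certs v)

least-unique : ∀ {P : ℕ → Set} {m n} →
               P m → (∀ {k} → k < m → ¬ P k) → P n → (∀ {k} → k < n → ¬ P k) → m ≡ n
least-unique {m = m} {n} Pm m-least Pn n-least with ℕP.<-cmp m n
... | tri< m<n _ _ = ⊥-elim (n-least m<n Pm)
... | tri≈ _ m≡n _ = m≡n
... | tri> _ _ n<m = ⊥-elim (m-least n<m Pn)

-- Any candidate would do: SeqCert checks that it is the first return to β.
returnTime : V → V → ℕ
returnTime α β = search (length allW) 0
  where
  search : ℕ → ℕ → ℕ
  search zero       k = k
  search (suc fuel) k = if does (gammaSeq α β k ≟V β) then k else search fuel (suc k)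

ConfigCert : ∀ {q} → StepTable → (Fin q → V) → Set
ConfigCert table Π = ConfigCertAt table Π (Vec.tabulate (rootIndex ∘ Π))

SeqCert : StepTable → V → V → ℕ → Set
SeqCert table α β k =
  gammaSeq α β k ≡ β × (∀ {i} → i < k → gammaSeq α β i ≢ β) × ConfigCert table (PiSeq α β (suc k))

PairCert : StepTable → V → V → Set
PairCert table α β = pair α β ≤ℤ 0ℤ → α ≢ negV β → SeqCert table α β (returnTime α β)

pairCert? : ∀ table α β → Dec (PairCert table α β)
pairCert? table α β =
  pair α β ℤ.≤? 0ℤ →-dec ¬? (α ≟V negV β) →-dec
    gammaSeq α β k ≟V β
    ×-dec ℕP.allUpTo? (λ i → ¬? (gammaSeq α β i ≟V β)) k
    ×-dec configCertAt? table (PiSeq α β (suc k)) (Vec.tabulate (rootIndex ∘ PiSeq α β (suc k)))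
  where
  k : ℕ
  k = returnTime α β

AllPairsCert : StepTable → Set
AllPairsCert table = All (λ α → All (PairCert table α) roots) roots

allPairsCert? : ∀ table → Dec (AllPairsCert table)
allPairsCert? table = All.all? (λ α → All.all? (pairCert? table α) roots) roots

configSound-reindex : ∀ {table} → CorrectStepTable table → ∀ {α β q k} → q ≡ k →
  ConfigCert table (PiSeq α β (suc k)) →
  (v : W) (p : List (Fin (suc q))) → InP (PiSeq α β (suc q)) v p →
  ¬ Exceptional (PiSeq α β (suc q)) v p →
  ExactlyOne (PiSeq α β (suc q)) v p
configSound-reindex {table} spec {α} {β} {q} refl =
  configSound {table} spec {Π = PiSeq α β (suc q)} {ix = Vec.tabulate (rootIndex ∘ PiSeq α β (suc q))}

pairSound : ∀ {table} → CorrectStepTable table → ∀ {α β} → PairCert table α β →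
  pair α β ≤ℤ 0ℤ → α ≢ negV β →
  (q : ℕ) → 1 ≤ q → gammaSeq α β (q ∸ 1) ≡ β →
  (∀ k → k < q ∸ 1 → gammaSeq α β k ≢ β) →
  (v : W) (p : List (Fin q)) → InP (PiSeq α β q) v p →
  ¬ Exceptional (PiSeq α β q) v p →
  ExactlyOne (PiSeq α β q) v p
pairSound {table} spec {α} {β} cert le ne (suc q) _ returns first =
  configSound-reindex {table} spec {α} {β} (least-unique returns (λ {k} → first k) returns′ first′) config
  where
  seqCert : SeqCert table α β (returnTime α β)
  seqCert = cert le ne
  returns′ : gammaSeq α β (returnTime α β) ≡ β
  returns′ = proj₁ seqCert
  first′ : ∀ {i} → i < returnTime α β → gammaSeq α β i ≢ β
  first′ = proj₁ (proj₂ seqCert)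
  config : ConfigCert table (PiSeq α β (suc (returnTime α β)))
  config = proj₂ (proj₂ seqCert)

from-does : {A : Set} (a? : Dec A) → does a? ≡ true → A
from-does (yes a) _ = a
from-does (no _) ()

-- Checked by `refl` rather than as `True _`: the decision is then computed in a single
-- evaluation, which shares the step table.
allPairsCert : AllPairsCert stepTable
allPairsCert = from-does (allPairsCert? stepTable) refl

proposition4p7 :
    (α β : V) → IsRoot α → IsRoot β →
    pair α β ≤ℤ 0ℤ → α ≢ negV β →
    (q : ℕ) → 1 ≤ q → gammaSeq α β (q Data.Nat.∸ 1) ≡ β →
    (∀ k → k < q Data.Nat.∸ 1 → gammaSeq α β k ≢ β) →
    (v : W) (p : List (Fin q)) → InP (PiSeq α β q) v p →
    ¬ Exceptional (PiSeq α β q) v p →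
    ExactlyOne (PiSeq α β q) v p
proposition4p7 α β α∈roots β∈roots =
  pairSound {stepTable} stepTable-correct {α} {β} (All.lookup (All.lookup allPairsCert α∈roots) β∈roots)
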